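{- For all positive integers $a,n$, $$\nu_5 \left( {5^a n \choose n}_F \right) = \nu_5 \left( {5^a n \choose n} \right) = \frac{s_5 ((5^a - 1)n)}{4}.$$ In particular, ${5^an \choose n}_F$ is divisible by $5$ for all positive integers $a,n$.
   Context: The Fibonacci sequence is $F_1=F_2=1$, $F_n=F_{n-1}+F_{n-2}$ for $n\ge 3$. For $m\ge 1$ and $1\le k\le m$ the Fibonomial coefficient is ${m \choose k}_F = \frac{F_1F_2\cdots F_m}{(F_1\cdots F_k)(F_1\cdots F_{m-k})}$ (an integer). $\nu_5(x)$ is the exponent of $5$ in $x$, ${m\choose k}$ is the ordinary binomial coefficient, and $s_5(n)$ is the sum of the base-$5$ digits of $n$. -}

module Defs where

open import Data.Nat using (ℕ; zero; suc; _+_; _*_; _∸_; _^_; _≤_; _<_; z≤n; s≤s; NonZero; >-nonZero)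
open import Data.Nat.Properties using (+-mono-≤; *-mono-≤; ≤-trans; m≤m+n)
open import Data.Nat.DivMod using (_/_; _%_)
open import Data.Nat.Divisibility using (_∣_)
open import Data.Product using (_×_)
open import Relation.Nullary using (¬_)

F : ℕ → ℕ
F zero = zero
F (suc zero) = 1
F (suc (suc n)) = F (suc n) + F n

F-pos : ∀ n → 1 ≤ F (suc n)
F-pos zero = s≤s z≤n
F-pos (suc n) = ≤-trans (F-pos n) (m≤m+n (F (suc n)) (F n))

fibProd : ℕ → ℕ
fibProd zero = 1
fibProd (suc m) = fibProd m * F (suc m)

fibProd-pos : ∀ m → 1 ≤ fibProd m
fibProd-pos zero = s≤s z≤n
fibProd-pos (suc m) = *-mono-≤ (fibProd-pos m) (F-pos m)

fibDenom-nonZero : ∀ k l → NonZero (fibProd k * fibProd l)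
fibDenom-nonZero k l = >-nonZero (*-mono-≤ (fibProd-pos k) (fibProd-pos l))

fibonomial : ℕ → ℕ → ℕ
fibonomial m k = _/_ (fibProd m) (fibProd k * fibProd (m ∸ k)) {{fibDenom-nonZero k (m ∸ k)}}

-- ν₅ x ≡ e, expressed as a relation: 5^e divides x but 5^(e+1) does not
Val5 : ℕ → ℕ → Set
Val5 x e = (5 ^ e ∣ x) × ¬ (5 ^ suc e ∣ x)

-- sum of base-5 digits, with fuel (fuel ≥ n suffices)
s5-fuel : ℕ → ℕ → ℕ
s5-fuel zero n = zero
s5-fuel (suc f) zero = zero
s5-fuel (suc f) n@(suc _) = n % 5 + s5-fuel f (n / 5)

s5 : ℕ → ℕ
s5 n = s5-fuel n n

module Submission where

-- The key arithmetic fact is ν₅(F m) = ν₅(m) for m ≥ 1: the identity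
-- F(m + 5) = 5F(m + 1) + 3F(m) shows 5 ∣ F m ⇔ 5 ∣ m, and
-- F(5N) = 5·F(N)·Q with Q ≡ 1 (mod 5) by Cassini's identity, so each
-- factor 5 of the index contributes exactly one factor 5.  Hence ν₅(F₁⋯F_m) = ν₅(m!).  Both coefficients
-- are the quotient of such a "factorial" of k + l by those of k and l, so
-- they share the valuation e, and Legendre's formula 4ν₅(m!) = m − s₅(m)
-- gives Kummer's count 4e = s₅(k) + s₅(l) − s₅(k + l).  For k = n and
-- l = (5ᵃ − 1)n we have s₅(k + l) = s₅(5ᵃn) = s₅(n), so 4e = s₅(l) > 0.

open import Defs
open import Data.Nat using (ℕ; suc; _*_; _∸_; _^_; _≤_)
open import Data.Nat.Combinatorics using (_C_)
open import Data.Nat.Divisibility using (_∣_)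
open import Data.Product using (_×_; ∃-syntax)
open import Relation.Binary.PropositionalEquality using (_≡_)

open import Data.Nat
open import Data.Nat.Properties
open import Data.Nat.DivMod
open import Data.Nat.Divisibility
open import Data.Nat.Primality using (Prime; prime?; euclidsLemma)
open import Data.Nat.Induction using (<-rec)
open import Data.Nat.Combinatorics using (nCk≡n!/k![n-k]!; k![n∸k]!∣n!)
open import Data.Nat.Tactic.RingSolver using (solve-∀)
open import Data.Product using (_,_; proj₁)
open import Data.Sum using (_⊎_; inj₁; inj₂; [_,_]′)
open import Data.Empty using (⊥-elim)
open import Function using (id; _∘_)
open import Relation.Nullary using (¬_; yes; no)
open import Relation.Nullary.Decidable using (toWitness)
open import Relation.Binary.PropositionalEquality
open ≡-Reasoning

fib-add : ∀ a b → F (suc (a + b)) ≡ F (suc a) * F (suc b) + F a * F b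
fib-add zero b = sym (trans (+-identityʳ _) (+-identityʳ _))
fib-add (suc a) b = begin
  F (suc (suc (a + b)))                            ≡⟨ cong (F ∘ suc) (sym (+-suc a b)) ⟩
  F (suc (a + suc b))                              ≡⟨ fib-add a (suc b) ⟩
  F (suc a) * (F (suc b) + F b) + F a * F (suc b)  ≡⟨ regroup (F (suc a)) (F a) (F (suc b)) (F b) ⟩
  (F (suc a) + F a) * F (suc b) + F (suc a) * F b  ∎
  where
  regroup : ∀ p q r s → p * (r + s) + q * r ≡ (p + q) * r + p * s
  regroup = solve-∀

-- The addition formula for a shift by N = m + 1, in the two forms needed
-- to advance the pair (F a, F(a + 1)) to (F(a + N), F(a + N + 1)).
fib-shift : ∀ a m → F (a + suc m) ≡ F (suc a) * F (suc m) + F a * F m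
fib-shift a m = trans (cong F (+-suc a m)) (fib-add a m)

fib-shift-suc : ∀ a m → F (suc (a + suc m)) ≡ F (suc a) * (F (suc m) + F m) + F a * F (suc m)
fib-shift-suc a m = begin
  F (suc (a + suc m))                                  ≡⟨ cong (F ∘ suc) (+-suc a m) ⟩
  F (suc (suc a + m))                                  ≡⟨ fib-add (suc a) m ⟩
  (F (suc a) + F a) * F (suc m) + F (suc a) * F m      ≡⟨ regroup (F (suc a)) (F a) (F (suc m)) (F m) ⟩
  F (suc a) * (F (suc m) + F m) + F a * F (suc m)      ∎
  where
  regroup : ∀ p q x z → (p + q) * x + p * z ≡ p * (x + z) + q * x
  regroup = solve-∀

-- With x = F N and z = F(N − 1), one step (u, v) = (F(jN), F(jN + 1)) ↦
-- (F((j+1)N), F((j+1)N + 1)) is a linear map; iterating it j times from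
-- (F 0, F 1) = (0, 1) yields the multiples of N.
advance : ℕ → ℕ → ℕ × ℕ → ℕ × ℕ
advance x z (u , v) = v * x + u * z , v * (x + z) + u * x

fibMultiples : ℕ → ℕ → ℕ → ℕ × ℕ
fibMultiples x z zero    = 0 , 1
fibMultiples x z (suc j) = advance x z (fibMultiples x z j)

fib-multiples : ∀ m j → fibMultiples (F (suc m)) (F m) j ≡ (F (j * suc m) , F (suc (j * suc m)))
fib-multiples m zero = refl
fib-multiples m (suc j) rewrite fib-multiples m j = cong₂ _,_
  (trans (sym (fib-shift (j * suc m) m)) (cong F (+-comm (j * suc m) (suc m))))
  (trans (sym (fib-shift-suc (j * suc m) m)) (cong (F ∘ suc) (+-comm (j * suc m) (suc m))))

-- The cofactor Q in F(5N) = 5 F(N) Q, written with w = z(x + z) = F(N−1) F(N+1).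
quinticFactor : ℕ → ℕ → ℕ
quinticFactor x z = let w = z * (x + z) in w * w + 3 * (x * x) * w + (x * x) * (x * x)

fibMultiples-5 : ∀ x z → proj₁ (fibMultiples x z 5) ≡ 5 * x * quinticFactor x z
fibMultiples-5 = expand
  where
  expand : ∀ x z →
    let u₁ = 1 * x + 0 * z ; v₁ = 1 * (x + z) + 0 * x
        u₂ = v₁ * x + u₁ * z ; v₂ = v₁ * (x + z) + u₁ * x
        u₃ = v₂ * x + u₂ * z ; v₃ = v₂ * (x + z) + u₂ * x
        u₄ = v₃ * x + u₃ * z ; v₄ = v₃ * (x + z) + u₃ * x
        w = z * (x + z)
    in v₄ * x + u₄ * z ≡ 5 * x * (w * w + 3 * (x * x) * w + (x * x) * (x * x))
  expand = solve-∀

fib-quintuple : ∀ m → F (5 * suc m) ≡ 5 * F (suc m) * quinticFactor (F (suc m)) (F m)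
fib-quintuple m = trans (cong proj₁ (sym (fib-multiples m 5))) (fibMultiples-5 (F (suc m)) (F m))

cassini : ∀ m → F m * F (suc (suc m)) + 1 ≡ F (suc m) * F (suc m)
              ⊎ F m * F (suc (suc m)) ≡ F (suc m) * F (suc m) + 1
cassini zero = inj₁ refl
cassini (suc m) with cassini m
... | inj₁ h = inj₂ (begin
  b * ((b + a) + b)              ≡⟨ expand a b ⟩
  b * (b + a) + b * b            ≡⟨ cong (b * (b + a) +_) (sym h) ⟩
  b * (b + a) + (a * (b + a) + 1) ≡⟨ collect a b ⟩
  (b + a) * (b + a) + 1          ∎)
  where
  a = F m
  b = F (suc m)
  expand : ∀ a b → b * ((b + a) + b) ≡ b * (b + a) + b * b
  expand = solve-∀
  collect : ∀ a b → b * (b + a) + (a * (b + a) + 1) ≡ (b + a) * (b + a) + 1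
  collect = solve-∀
... | inj₂ h = inj₁ (begin
  b * ((b + a) + b) + 1          ≡⟨ expand a b ⟩
  b * (b + a) + (b * b + 1)      ≡⟨ cong (b * (b + a) +_) (sym h) ⟩
  b * (b + a) + a * (b + a)      ≡⟨ collect a b ⟩
  (b + a) * (b + a)              ∎)
  where
  a = F m
  b = F (suc m)
  expand : ∀ a b → b * ((b + a) + b) + 1 ≡ b * (b + a) + (b * b + 1)
  expand = solve-∀
  collect : ∀ a b → b * (b + a) + a * (b + a) ≡ (b + a) * (b + a)
  collect = solve-∀

quinticFactor≡1 : ∀ x z → z * (x + z) + 1 ≡ x * x ⊎ z * (x + z) ≡ x * x + 1
                → ∃[ t ] quinticFactor x z ≡ 5 * t + 1
quinticFactor≡1 x z (inj₁ x²≡w+1) = w * w + w ,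
  trans (cong (λ s → w * w + 3 * s * w + s * s) (sym x²≡w+1)) (reduce w)
  where
  w = z * (x + z)
  reduce : ∀ w → w * w + 3 * (w + 1) * w + (w + 1) * (w + 1) ≡ 5 * (w * w + w) + 1
  reduce = solve-∀
quinticFactor≡1 x z (inj₂ w≡x²+1) = s * s + s ,
  trans (cong (λ w → w * w + 3 * s * w + s * s) w≡x²+1) (reduce s)
  where
  s = x * x
  reduce : ∀ s → (s + 1) * (s + 1) + 3 * s * (s + 1) + s * s ≡ 5 * (s * s + s) + 1
  reduce = solve-∀

prime5 : Prime 5
prime5 = toWitness {a? = prime? 5} _

5∤small : ∀ {k} → 0 < k → k < 5 → ¬ 5 ∣ k
5∤small {suc k} _ k<5 5∣k = <⇒≱ k<5 (∣⇒≤ 5∣k)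

5∤last-digit : ∀ {r} q → 0 < r → r < 5 → ¬ 5 ∣ r + q * 5
5∤last-digit q 0<r r<5 5∣r+5q = 5∤small 0<r r<5 (∣m+n∣m⇒∣n (subst (5 ∣_) (+-comm _ (q * 5)) 5∣r+5q) (n∣m*n q))

-- 5 ∣ F n only when 5 ∣ n: F(n + 5) = 5 F(n + 1) + 3 F(n), so the
-- divisibility is 5-periodic, and F 1, …, F 4 = 1, 1, 2, 3.
5∣fib⇒5∣index : ∀ n → 5 ∣ F n → 5 ∣ n
5∣fib⇒5∣index 0 _ = 5 ∣0
5∣fib⇒5∣index 1 5∣F = ⊥-elim (5∤small z<s (s<s z<s) 5∣F)
5∣fib⇒5∣index 2 5∣F = ⊥-elim (5∤small z<s (s<s z<s) 5∣F)
5∣fib⇒5∣index 3 5∣F = ⊥-elim (5∤small z<s (s<s (s<s z<s)) 5∣F)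
5∣fib⇒5∣index 4 5∣F = ⊥-elim (5∤small z<s (s<s (s<s (s<s z<s))) 5∣F)
5∣fib⇒5∣index (suc (suc (suc (suc (suc n))))) 5∣F = ∣m∣n⇒∣m+n ∣-refl (5∣fib⇒5∣index n 5∣Fn)
  where
  5∣3Fn : 5 ∣ 3 * F n
  5∣3Fn = ∣m+n∣m⇒∣n (subst (5 ∣_) (fib-add 4 n) 5∣F) (m∣m*n (F (suc n)))
  5∣Fn : 5 ∣ F n
  5∣Fn = [ ⊥-elim ∘ 5∤small z<s (s<s (s<s (s<s z<s))) , id ]′ (euclidsLemma 3 (F n) prime5 5∣3Fn)

record Exact5 (x e : ℕ) : Set where
  constructor exact5
  field
    unit          : ℕ
    factorisation : x ≡ 5 ^ e * unit
    unit-coprime  : ¬ 5 ∣ unit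

5∣5^suc : ∀ f v → 5 ∣ 5 ^ suc f * v
5∣5^suc f v = ∣-trans (m∣m*n (5 ^ f)) (m∣m*n v)

exact5⇒Val5 : ∀ {x e} → Exact5 x e → Val5 x e
exact5⇒Val5 {e = e} (exact5 u refl 5∤u) = divides u (*-comm (5 ^ e) u) , λ 5^e⁺¹∣x →
  5∤u (*-cancelˡ-∣ (5 ^ e) {{m^n≢0 5 e}} (subst (_∣ 5 ^ e * u) (*-comm 5 (5 ^ e)) 5^e⁺¹∣x))

exact5-pos : ∀ {x e} → Exact5 x e → 0 < x
exact5-pos (exact5 zero _ 5∤0) = ⊥-elim (5∤0 (5 ∣0))
exact5-pos {e = e} (exact5 (suc u) refl _) = *-mono-≤ (m^n>0 5 e) z<s

exact5-coprime : ∀ {x} → ¬ 5 ∣ x → Exact5 x 0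
exact5-coprime {x} 5∤x = exact5 x (sym (*-identityˡ x)) 5∤x

exact5-*5 : ∀ {x e} → Exact5 x e → Exact5 (x * 5) (suc e)
exact5-*5 {e = e} (exact5 u refl 5∤u) = exact5 u (regroup (5 ^ e) u) 5∤u
  where
  regroup : ∀ p u → p * u * 5 ≡ 5 * p * u
  regroup = solve-∀

exact5-* : ∀ {x y e f} → Exact5 x e → Exact5 y f → Exact5 (x * y) (e + f)
exact5-* {e = e} {f} (exact5 u refl 5∤u) (exact5 v refl 5∤v) =
  exact5 (u * v) (trans (interchange (5 ^ e) (5 ^ f) u v) (cong (_* (u * v)) (sym (^-distribˡ-+-* 5 e f))))
    (λ 5∣uv → [ 5∤u , 5∤v ]′ (euclidsLemma u v prime5 5∣uv))
  where
  interchange : ∀ p q u v → (p * u) * (q * v) ≡ (p * q) * (u * v)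
  interchange = solve-∀

exact5-unique : ∀ {x e f} → Exact5 x e → Exact5 x f → e ≡ f
exact5-unique {e = e} {f} (exact5 u refl 5∤u) (exact5 v eq 5∤v) = powers e f eq 5∤u 5∤v
  where
  powers : ∀ e f {u v} → 5 ^ e * u ≡ 5 ^ f * v → ¬ 5 ∣ u → ¬ 5 ∣ v → e ≡ f
  powers zero zero _ _ _ = refl
  powers zero (suc f) {u} {v} eq 5∤u _ = ⊥-elim (5∤u (subst (5 ∣_) (trans (sym eq) (*-identityˡ u)) (5∣5^suc f v)))
  powers (suc e) zero {u} {v} eq _ 5∤v = ⊥-elim (5∤v (subst (5 ∣_) (trans eq (*-identityˡ v)) (5∣5^suc e u)))
  powers (suc e) (suc f) {u} {v} eq 5∤u 5∤v = cong suc (powers e f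
    (*-cancelˡ-≡ _ _ 5 (trans (sym (*-assoc 5 (5 ^ e) u)) (trans eq (*-assoc 5 (5 ^ f) v)))) 5∤u 5∤v)

exact5-exists : ∀ x → 0 < x → ∃[ e ] Exact5 x e
exact5-exists = <-rec _ divideOut
  where
  divideOut : ∀ x → (∀ {y} → y < x → 0 < y → ∃[ e ] Exact5 y e) → 0 < x → ∃[ e ] Exact5 x e
  divideOut x rec 0<x with 5 ∣? x
  ... | no 5∤x = 0 , exact5-coprime 5∤x
  ... | yes (divides (suc q) refl) with rec (m<m*n (suc q) 5 (s<s z<s)) z<s
  ...   | e , v = suc e , exact5-*5 v

exact5-quotient : ∀ {x q y E f} → x ≡ q * y → Exact5 x E → Exact5 y f → ∃[ h ] Exact5 q h × h + f ≡ E
exact5-quotient {q = zero} refl vx _ = ⊥-elim (<-irrefl refl (exact5-pos vx))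
exact5-quotient {q = suc q} refl vx vy with exact5-exists (suc q) z<s
... | h , vq = h , vq , exact5-unique (exact5-* vq vy) vx

-- Multiplying the index by 5 raises ν₅(F) by exactly one, since Q ≡ 1 (mod 5).
exact5-fib-quintuple : ∀ m {e} → Exact5 (F (suc m)) e → Exact5 (F (5 * suc m)) (suc e)
exact5-fib-quintuple m {e} v with quinticFactor≡1 (F (suc m)) (F m) (cassini m)
... | t , Q≡5t+1 = subst (λ y → Exact5 y (suc e)) (sym F5N≡) (subst (Exact5 _) (+-identityʳ (suc e)) product)
  where
  F5N≡ : F (5 * suc m) ≡ F (suc m) * 5 * (1 + t * 5)
  F5N≡ = trans (fib-quintuple m)
    (trans (cong (5 * F (suc m) *_) (trans Q≡5t+1 (trans (+-comm (5 * t) 1) (cong (1 +_) (*-comm 5 t)))))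
           (cong (_* (1 + t * 5)) (*-comm 5 (F (suc m)))))
  product : Exact5 (F (suc m) * 5 * (1 + t * 5)) (suc e + 0)
  product = exact5-* (exact5-*5 v) (exact5-coprime (5∤last-digit t z<s (s<s z<s)))

exact5-fib : ∀ {n e} → Exact5 n e → Exact5 (F n) e
exact5-fib {e = e} (exact5 u refl 5∤u) = fib-val e 5∤u
  where
  fib-val : ∀ e {u} → ¬ 5 ∣ u → Exact5 (F (5 ^ e * u)) e
  fib-val zero {u} 5∤u = subst (λ y → Exact5 (F y) 0) (sym (*-identityˡ u))
    (exact5-coprime (5∤u ∘ 5∣fib⇒5∣index u))
  fib-val (suc e) {u} 5∤u = subst (λ y → Exact5 (F y) (suc e)) (sym (*-assoc 5 (5 ^ e) u))
    (times5 (exact5-pos {e = e} (exact5 u refl 5∤u)) (fib-val e 5∤u))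
    where
    times5 : ∀ {N} → 0 < N → Exact5 (F N) e → Exact5 (F (5 * N)) (suc e)
    times5 {suc m} _ = exact5-fib-quintuple m

fibProd-factorial-exact5 : ∀ m → ∃[ e ] Exact5 (fibProd m) e × Exact5 (m !) e
fibProd-factorial-exact5 zero = 0 , exact5-coprime 5∤1 , exact5-coprime 5∤1
  where 5∤1 = 5∤small z<s (s<s z<s)
fibProd-factorial-exact5 (suc m) with fibProd-factorial-exact5 m | exact5-exists (suc m) z<s
... | e , vF , v! | d , v = e + d , exact5-* vF (exact5-fib v) , subst (Exact5 _) (+-comm d e) (exact5-* v v!)

s5-fuel-enough : ∀ f g n → n ≤ f → n ≤ g → s5-fuel f n ≡ s5-fuel g n
s5-fuel-enough zero    zero    zero    _ _ = refl
s5-fuel-enough zero    (suc g) zero    _ _ = refl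
s5-fuel-enough (suc f) zero    zero    _ _ = refl
s5-fuel-enough (suc f) (suc g) zero    _ _ = refl
s5-fuel-enough (suc f) (suc g) (suc n) n<f n<g = cong (suc n % 5 +_)
  (s5-fuel-enough f g (suc n / 5) (≤-pred (≤-trans n/5<n n<f)) (≤-pred (≤-trans n/5<n n<g)))
  where n/5<n = m/n<m (suc n) 5 (s<s z<s)

s5-unfold : ∀ n → s5 n ≡ n % 5 + s5 (n / 5)
s5-unfold zero = refl
s5-unfold (suc n) = cong (suc n % 5 +_)
  (s5-fuel-enough n (suc n / 5) (suc n / 5) (≤-pred (m/n<m (suc n) 5 (s<s z<s))) ≤-refl)

s5-digit : ∀ r q → r < 5 → s5 (r + q * 5) ≡ r + s5 q
s5-digit r q r<5 = begin
  s5 (r + q * 5)                          ≡⟨ s5-unfold (r + q * 5) ⟩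
  (r + q * 5) % 5 + s5 ((r + q * 5) / 5)  ≡⟨ cong₂ (λ d p → d + s5 p) remainder≡r quotient≡q ⟩
  r + s5 q                                ∎
  where
  remainder≡r : (r + q * 5) % 5 ≡ r
  remainder≡r = trans ([m+kn]%n≡m%n r q 5) (m<n⇒m%n≡m r<5)
  quotient≡q : (r + q * 5) / 5 ≡ q
  quotient≡q = trans (+-distrib-/ r (q * 5) (subst₂ (λ a b → a + b < 5) (sym (m<n⇒m%n≡m r<5)) (sym (m*n%n≡0 q 5)) (subst (_< 5) (sym (+-identityʳ r)) r<5)))
                   (cong₂ _+_ (m<n⇒m/n≡0 r<5) (m*n/n≡m q 5))

s5-*5^ : ∀ a n → s5 (5 ^ a * n) ≡ s5 n
s5-*5^ zero n = cong s5 (*-identityˡ n)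
s5-*5^ (suc a) n = begin
  s5 (5 ^ suc a * n)        ≡⟨ cong s5 (regroup (5 ^ a) n) ⟩
  s5 (0 + (5 ^ a * n) * 5)  ≡⟨ s5-digit 0 (5 ^ a * n) z<s ⟩
  s5 (5 ^ a * n)            ≡⟨ s5-*5^ a n ⟩
  s5 n                      ∎
  where
  regroup : ∀ p n → 5 * p * n ≡ 0 + p * n * 5
  regroup = solve-∀

s5≡0⇒≡0 : ∀ n → s5 n ≡ 0 → n ≡ 0
s5≡0⇒≡0 = <-rec _ digits
  where
  digits : ∀ n → (∀ {y} → y < n → s5 y ≡ 0 → y ≡ 0) → s5 n ≡ 0 → n ≡ 0
  digits zero _ _ = refl
  digits n@(suc _) rec s5n≡0 = begin
    n                  ≡⟨ m≡m%n+[m/n]*n n 5 ⟩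
    n % 5 + n / 5 * 5  ≡⟨ cong₂ (λ r q → r + q * 5) (m+n≡0⇒m≡0 (n % 5) split) (rec (m/n<m n 5 (s<s z<s)) (m+n≡0⇒n≡0 (n % 5) split)) ⟩
    0                  ∎
    where
    split : n % 5 + s5 (n / 5) ≡ 0
    split = trans (sym (s5-unfold n)) s5n≡0

-- The last base-5 digit of n: either below 4 (adding 1 carries nothing)
-- or exactly 4 (adding 1 carries into the next digit).
data LastDigit : ℕ → Set where
  below4 : ∀ r q → r < 4 → LastDigit (r + q * 5)
  four   : ∀ q → LastDigit (4 + q * 5)

lastDigit : ∀ n → LastDigit n
lastDigit n = subst LastDigit (sym (m≡m%n+[m/n]*n n 5)) (classify (n % 5) (n / 5) (m%n<n n 5))
  where
  classify : ∀ r q → r < 5 → LastDigit (r + q * 5)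
  classify r q r<5 with r ≟ 4
  ... | yes refl = four q
  ... | no r≢4 = below4 r q (≤∧≢⇒< (≤-pred r<5) r≢4)

-- Adding 1 raises the digit sum by 1, minus 4 per carry, and the number of
-- carries is ν₅(n + 1).
s5-suc : ∀ n {e} → Exact5 (suc n) e → s5 n + 1 ≡ s5 (suc n) + 4 * e
s5-suc = <-rec _ carries
  where
  carries : ∀ n → (∀ {y} → y < n → ∀ {e} → Exact5 (suc y) e → s5 y + 1 ≡ s5 (suc y) + 4 * e)
          → ∀ {e} → Exact5 (suc n) e → s5 n + 1 ≡ s5 (suc n) + 4 * e
  carries n rec {e} v with lastDigit n
  ... | below4 r q r<4 = begin
    s5 (r + q * 5) + 1           ≡⟨ cong (_+ 1) (s5-digit r q (m<n⇒m<1+n r<4)) ⟩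
    r + s5 q + 1                 ≡⟨ noCarry r (s5 q) ⟩
    suc r + s5 q + 4 * 0         ≡⟨ cong₂ (λ s d → s + 4 * d) (sym (s5-digit (suc r) q (s<s r<4))) e≡0 ⟩
    s5 (suc r + q * 5) + 4 * e   ∎
    where
    e≡0 = exact5-unique (exact5-coprime (5∤last-digit q z<s (s<s r<4))) v
    noCarry : ∀ r s → r + s + 1 ≡ suc r + s + 4 * 0
    noCarry = solve-∀
  ... | four q with exact5-exists (suc q) z<s
  ...   | d , v′ = begin
    s5 (4 + q * 5) + 1               ≡⟨ cong (_+ 1) (s5-digit 4 q (s<s (s<s (s<s (s<s z<s))))) ⟩
    4 + s5 q + 1                     ≡⟨ cong (4 +_) (rec q<n v′) ⟩
    4 + (s5 (suc q) + 4 * d)         ≡⟨ carry (s5 (suc q)) d ⟩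
    s5 (suc q) + 4 * suc d           ≡⟨ cong₂ (λ s c → s + 4 * c) (sym (s5-digit 0 (suc q) z<s)) e≡d+1 ⟩
    s5 (suc (4 + q * 5)) + 4 * e     ∎
    where
    q<n : q < 4 + q * 5
    q<n = s<s (≤-trans (m≤m*n q 5) (m≤n+m (q * 5) 3))
    e≡d+1 = exact5-unique (exact5-*5 v′) v
    carry : ∀ s d → 4 + (s + 4 * d) ≡ s + 4 * suc d
    carry = solve-∀

legendre : ∀ m → ∃[ e ] Exact5 (m !) e × 4 * e + s5 m ≡ m
legendre zero = 0 , exact5-coprime (5∤small z<s (s<s z<s)) , refl
legendre (suc m) with legendre m | exact5-exists (suc m) z<s
... | e , v! , eq | d , v = d + e , exact5-* v v! , (begin
  4 * (d + e) + s5 (suc m)       ≡⟨ regroup d e (s5 (suc m)) ⟩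
  (s5 (suc m) + 4 * d) + 4 * e   ≡⟨ cong (_+ 4 * e) (sym (s5-suc m v)) ⟩
  (s5 m + 1) + 4 * e             ≡⟨ collect (s5 m) e ⟩
  suc (4 * e + s5 m)             ≡⟨ cong suc eq ⟩
  suc m                          ∎)
  where
  regroup : ∀ d e s → 4 * (d + e) + s ≡ (s + 4 * d) + 4 * e
  regroup = solve-∀
  collect : ∀ s e → (s + 1) + 4 * e ≡ 1 + (4 * e + s)
  collect = solve-∀

fibProd-legendre : ∀ m → ∃[ e ] Exact5 (fibProd m) e × Exact5 (m !) e × 4 * e + s5 m ≡ m
fibProd-legendre m with fibProd-factorial-exact5 m | legendre m
... | e , vF , v! | e′ , v!′ , eq = e , vF , v! , subst (λ c → 4 * c + s5 m ≡ m) (exact5-unique v!′ v!) eq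

-- [k + l, k]_F via the Pascal-type recurrence
-- [k+l+2, k+1]_F = F(l+2)·[k+l+1, k]_F + F(k)·[k+l+1, k+1]_F.
fibonomialRec : ℕ → ℕ → ℕ
fibonomialRec zero    l       = 1
fibonomialRec (suc k) zero    = 1
fibonomialRec (suc k) (suc l) = F (suc (suc l)) * fibonomialRec k (suc l) + F k * fibonomialRec (suc k) l

fibProd-split : ∀ k l → fibProd (k + l) ≡ fibonomialRec k l * (fibProd k * fibProd l)
fibProd-split zero l = sym (trans (*-identityˡ _) (*-identityˡ _))
fibProd-split (suc k) zero = trans (cong fibProd (+-identityʳ (suc k))) (sym (trans (*-identityˡ _) (*-identityʳ _)))
fibProd-split (suc k) (suc l) = begin
  P * F (suc (k + suc l))                                 ≡⟨ cong (P *_) (fib-add k (suc l)) ⟩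
  P * (F (suc k) * F (suc (suc l)) + F k * F (suc l))     ≡⟨ *-distribˡ-+ P _ _ ⟩
  P * (F (suc k) * F (suc (suc l))) + P * (F k * F (suc l))
    ≡⟨ cong₂ _+_ (cong (_* (F (suc k) * F (suc (suc l)))) (fibProd-split k (suc l)))
                 (cong (_* (F k * F (suc l))) (trans (cong fibProd (+-suc k l)) (fibProd-split (suc k) l))) ⟩
  _                                                       ≡⟨ regroup (fibonomialRec k (suc l)) (fibonomialRec (suc k) l)
                                                                     (fibProd k) (F (suc k)) (F k) (fibProd l) (F (suc l)) (F (suc (suc l))) ⟩
  fibonomialRec (suc k) (suc l) * (fibProd (suc k) * fibProd (suc l)) ∎
  where
  P = fibProd (k + suc l)
  regroup : ∀ h₁ h₂ pk fsk fk pl fsl fssl →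
    (h₁ * (pk * (pl * fsl))) * (fsk * fssl) + (h₂ * ((pk * fsk) * pl)) * (fk * fsl)
      ≡ (fssl * h₁ + fk * h₂) * ((pk * fsk) * (pl * fsl))
  regroup = solve-∀

fibonomial≡rec : ∀ k l → fibonomial (k + l) k ≡ fibonomialRec k l
fibonomial≡rec k l rewrite m+n∸m≡n k l | fibProd-split k l =
  m*n/n≡m (fibonomialRec k l) (fibProd k * fibProd l) {{fibDenom-nonZero k l}}

factorial-split : ∀ k l → (k + l) ! ≡ ((k + l) C k) * (k ! * l !)
factorial-split k l = begin
  (k + l) !                                          ≡⟨ m/n*n≡m {{nz}} (k![n∸k]!∣n! (m≤m+n k l)) ⟨
  ((k + l) ! / (k ! * (k + l ∸ k) !)) {{nz}} * (k ! * (k + l ∸ k) !)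
    ≡⟨ cong₂ _*_ (sym (nCk≡n!/k![n-k]! (m≤m+n k l))) (cong (λ y → k ! * y !) (m+n∸m≡n k l)) ⟩
  ((k + l) C k) * (k ! * l !)                        ∎
  where
  nz : NonZero (k ! * (k + l ∸ k) !)
  nz = k !* (k + l ∸ k) !≢0

coefficients-exact5 : ∀ k l → ∃[ e ] Exact5 (fibonomial (k + l) k) e × Exact5 ((k + l) C k) e
                                      × 4 * e + s5 (k + l) ≡ s5 k + s5 l
coefficients-exact5 k l
  with fibProd-legendre k | fibProd-legendre l | fibProd-legendre (k + l)
... | ek , Fk , !k , Lk | el , Fl , !l , Ll | E , FE , !E , LE
  with exact5-quotient (fibProd-split k l) FE (exact5-* Fk Fl)
     | exact5-quotient (factorial-split k l) !E (exact5-* !k !l)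
... | h , vh , h+ | c , vc , c+ =
  h , subst (λ y → Exact5 y h) (sym (fibonomial≡rec k l)) vh , subst (Exact5 _) (sym h≡c) vc , kummer
  where
  h≡c : h ≡ c
  h≡c = +-cancelʳ-≡ (ek + el) h c (trans h+ (sym c+))
  kummer : 4 * h + s5 (k + l) ≡ s5 k + s5 l
  kummer = +-cancelˡ-≡ (4 * (ek + el)) _ _ (begin
    4 * (ek + el) + (4 * h + s5 (k + l))  ≡⟨ regroup (s5 (k + l)) h ek el ⟩
    4 * (h + (ek + el)) + s5 (k + l)      ≡⟨ cong (λ t → 4 * t + s5 (k + l)) h+ ⟩
    4 * E + s5 (k + l)                    ≡⟨ LE ⟩
    k + l                                 ≡⟨ cong₂ _+_ Lk Ll ⟨
    (4 * ek + s5 k) + (4 * el + s5 l)     ≡⟨ regroup′ (s5 k) (s5 l) ek el ⟩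
    4 * (ek + el) + (s5 k + s5 l)         ∎)
    where
    regroup : ∀ s h a b → 4 * (a + b) + (4 * h + s) ≡ 4 * (h + (a + b)) + s
    regroup = solve-∀
    regroup′ : ∀ s t a b → (4 * a + s) + (4 * b + t) ≡ 4 * (a + b) + (s + t)
    regroup′ = solve-∀

coefficients-val5 : ∀ k l → s5 (k + l) ≡ s5 k
                  → ∃[ e ] (Val5 (fibonomial (k + l) k) e × Val5 ((k + l) C k) e × 4 * e ≡ s5 l)
coefficients-val5 k l s5-same with coefficients-exact5 k l
... | e , vF , vC , defect = e , exact5⇒Val5 vF , exact5⇒Val5 vC ,
  +-cancelʳ-≡ (s5 k) _ _ (trans (cong (4 * e +_) (sym s5-same)) (trans defect (+-comm (s5 k) (s5 l))))

theorem11 : ∀ (a n : ℕ) → 1 ≤ a → 1 ≤ n →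
    (∃[ e ] (Val5 (fibonomial (5 ^ a * n) n) e × Val5 ((5 ^ a * n) C n) e × 4 * e ≡ s5 ((5 ^ a ∸ 1) * n)))
    × (5 ∣ fibonomial (5 ^ a * n) n)
theorem11 a n 1≤a 1≤n = valuation , 5∣coefficient valuation
  where
  l = (5 ^ a ∸ 1) * n
  5≤5^a : 5 ≤ 5 ^ a
  5≤5^a = ^-monoʳ-≤ 5 1≤a
  -- n + (5ᵃ − 1)n = 5ᵃn, whose digit sum is that of n.
  n+l≡5^an : n + l ≡ 5 ^ a * n
  n+l≡5^an = cong (_* n) (m+[n∸m]≡n (≤-trans (s≤s z≤n) 5≤5^a))
  valuation : ∃[ e ] (Val5 (fibonomial (5 ^ a * n) n) e × Val5 ((5 ^ a * n) C n) e × 4 * e ≡ s5 l)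
  valuation = subst (λ m → ∃[ e ] (Val5 (fibonomial m n) e × Val5 (m C n) e × 4 * e ≡ s5 l)) n+l≡5^an
    (coefficients-val5 n l (trans (cong s5 n+l≡5^an) (s5-*5^ a n)))
  -- l ≥ 1 forces s₅(l) > 0, hence e > 0.
  l≢0 : l ≢ 0
  l≢0 = ≢-nonZero⁻¹ l {{>-nonZero (*-mono-≤ (∸-monoˡ-≤ 1 (≤-trans (s≤s (s≤s z≤n)) 5≤5^a)) 1≤n)}}
  5∣coefficient : ∃[ e ] (Val5 (fibonomial (5 ^ a * n) n) e × Val5 ((5 ^ a * n) C n) e × 4 * e ≡ s5 l)
                → 5 ∣ fibonomial (5 ^ a * n) n
  5∣coefficient (zero , _ , _ , 0≡s5l) = ⊥-elim (l≢0 (s5≡0⇒≡0 l (sym 0≡s5l)))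
  5∣coefficient (suc e , (5^e⁺¹∣x , _) , _) = ∣-trans (m∣m*n (5 ^ e)) 5^e⁺¹∣x
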